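{- Let $\mathcal{L}$ be an expansion of the language $\langle +,<,0\rangle$ of ordered abelian groups, and let $G$ be an $\mathcal{L}$-structure whose reduct is a densely ordered abelian group. If $G$ satisfies DCI, then the group $G$ is divisible.
   Context: For an $\mathcal{L}$-formula $\varphi(v,\bar w)$, $\mathrm{DCI}_\varphi$ is the sentence $\forall \bar w\big((\exists s\,\forall v<s\,\varphi(v,\bar w)\wedge \forall v(\forall s<v\,\varphi(s,\bar w)\rightarrow \exists u>v\,\forall s<u\,\varphi(s,\bar w)))\rightarrow \forall v\,\varphi(v,\bar w)\big)$; $G$ satisfies DCI if it satisfies $\mathrm{DCI}_\varphi$ for every $\mathcal{L}$-formula $\varphi(v,\bar w)$. -}

module Defs where

open import Data.Nat using (ℕ; zero; suc; _≟_)
open import Data.Vec using (Vec; []; _∷_)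
open import Data.Product using (Σ; _×_; _,_; ∃)
open import Data.Sum using (_⊎_)
open import Data.Empty using (⊥)
open import Data.Unit using (⊤)
open import Relation.Nullary using (¬_; yes; no)
open import Relation.Binary.PropositionalEquality using (_≡_)

record DOAG : Set₁ where
  field
    Carrier : Set
    _+_     : Carrier → Carrier → Carrier
    0#      : Carrier
    -_      : Carrier → Carrier
    _<_     : Carrier → Carrier → Set
    +-assoc     : ∀ x y z → (x + y) + z ≡ x + (y + z)
    +-comm      : ∀ x y → x + y ≡ y + x
    +-identityˡ : ∀ x → 0# + x ≡ x
    +-inverseˡ  : ∀ x → (- x) + x ≡ 0#
    <-irrefl    : ∀ x → ¬ (x < x)
    <-trans     : ∀ x y z → x < y → y < z → x < z
    <-trichot   : ∀ x y → (x < y) ⊎ ((x ≡ y) ⊎ (y < x))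
    <-+         : ∀ x y z → x < y → (x + z) < (y + z)
    <-dense     : ∀ x y → x < y → Σ Carrier λ z → (x < z) × (z < y)
  infixl 6 _+_
  infix 4 _<_

-- A language L expanding ⟨+,<,0⟩: the symbols +, <, 0 (and =) are
-- built in; L may add arbitrary function and relation symbols.

record Language : Set₁ where
  field
    Fun   : Set
    funAr : Fun → ℕ
    Rel   : Set
    relAr : Rel → ℕ

module Syntax (L : Language) where
  open Language L

  Var : Set
  Var = ℕ

  data Term : Set where
    var  : Var → Term
    zeroᵗ : Term
    _⊕_  : Term → Term → Term
    app  : (f : Fun) → Vec Term (funAr f) → Term

  data Formula : Set where
    _≐_  : Term → Term → Formula
    _≺_  : Term → Term → Formula
    rel  : (r : Rel) → Vec Term (relAr r) → Formula
    ⊤ᶠ ⊥ᶠ : Formula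
    ¬ᶠ_  : Formula → Formula
    _∧ᶠ_ _∨ᶠ_ _⇒ᶠ_ : Formula → Formula → Formula
    ∀ᶠ ∃ᶠ : Var → Formula → Formula

record Structure (L : Language) : Set₁ where
  open Language L
  field
    grp  : DOAG
  open DOAG grp public
  field
    funI : (f : Fun) → Vec Carrier (funAr f) → Carrier
    relI : (r : Rel) → Vec Carrier (relAr r) → Set

module Semantics {L : Language} (G : Structure L) where
  open Language L
  open Syntax L
  open Structure G

  Assignment : Set
  Assignment = Var → Carrier

  _[_↦_] : Assignment → Var → Carrier → Assignment
  (ρ [ x ↦ a ]) y with y ≟ x
  ... | yes _ = a
  ... | no  _ = ρ y

  mutual
    eval : Assignment → Term → Carrier
    eval ρ (var x)   = ρ x
    eval ρ zeroᵗ     = 0#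
    eval ρ (s ⊕ t)   = eval ρ s + eval ρ t
    eval ρ (app f ts) = funI f (evalVec ρ ts)

    evalVec : ∀ {n} → Assignment → Vec Term n → Vec Carrier n
    evalVec ρ []       = []
    evalVec ρ (t ∷ ts) = eval ρ t ∷ evalVec ρ ts

  Sat : Formula → Assignment → Set
  Sat (s ≐ t)    ρ = eval ρ s ≡ eval ρ t
  Sat (s ≺ t)    ρ = eval ρ s < eval ρ t
  Sat (rel r ts) ρ = relI r (evalVec ρ ts)
  Sat ⊤ᶠ         ρ = ⊤
  Sat ⊥ᶠ         ρ = ⊥
  Sat (¬ᶠ φ)     ρ = ¬ Sat φ ρ
  Sat (φ ∧ᶠ ψ)   ρ = Sat φ ρ × Sat ψ ρ
  Sat (φ ∨ᶠ ψ)   ρ = Sat φ ρ ⊎ Sat ψ ρ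
  Sat (φ ⇒ᶠ ψ)   ρ = Sat φ ρ → Sat ψ ρ
  Sat (∀ᶠ x φ)   ρ = (a : Carrier) → Sat φ (ρ [ x ↦ a ])
  Sat (∃ᶠ x φ)   ρ = Σ Carrier λ a → Sat φ (ρ [ x ↦ a ])

  -- DCI_φ for φ(v, w̄): v is variable 0, the parameters w̄ are the
  -- values of the remaining variables under an arbitrary assignment ρ.
  DCI-φ : Formula → Set
  DCI-φ φ = (ρ : Assignment) →
    let P : Carrier → Set
        P a = Sat φ (ρ [ 0 ↦ a ])
    in (Σ Carrier (λ s → ∀ v → v < s → P v))
     × (∀ v → (∀ s → s < v → P s) → Σ Carrier (λ u → (v < u) × (∀ s → s < u → P s)))
     → ∀ v → P v

  DCI : Set
  DCI = (φ : Formula) → DCI-φ φ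

  _·_ : ℕ → Carrier → Carrier
  zero  · g = 0#
  suc n · g = g + (n · g)

  Divisible : Set
  Divisible = ∀ (n : ℕ) → ¬ (n ≡ 0) → ∀ (g : Carrier) → Σ Carrier λ h → n · h ≡ g

-- Classical metatheory (the paper's ambient logic).
ExcludedMiddle : Set₁
ExcludedMiddle = (P : Set) → P ⊎ ¬ P

-- Fix n ≥ 1 and g not divisible by n, and let B = {v : n·v < g}, a set
-- defined by the formula n·v < w with parameter w := g. B contains a ray
-- (−∞, s) but not all of G. If B ⊇ (−∞, v) then n·v ≠ g; if n·v < g,
-- density gives e > 0 with n·e < g − n·v, so B ⊇ (−∞, v + e); if n·v > g,
-- take e > 0 with n·e < n·v − g, then v − e ∈ B gives the absurd
-- n·v = n·(v − e) + n·e < n·v. So DCI applies to B and yields B = G.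
module Submission where

open import Defs
open import Data.Nat using (ℕ; zero; suc)
open import Data.Product using (Σ; _×_; _,_)
open import Function using (case_of_)
open import Data.Sum using (_⊎_; inj₁; inj₂)
open import Data.Empty using (⊥-elim)
open import Relation.Nullary using (¬_)
open import Relation.Binary.PropositionalEquality
  using (_≡_; refl; sym; trans; cong; subst; subst₂; module ≡-Reasoning)

module DOAGProperties (D : DOAG) where
  open DOAG D

  infix 4 _≤_
  _≤_ : Carrier → Carrier → Set
  x ≤ y = (x < y) ⊎ (x ≡ y)

  infixl 6 _-_
  _-_ : Carrier → Carrier → Carrier
  x - y = x + (- y)

  ≤-refl : ∀ {x} → x ≤ x
  ≤-refl = inj₂ refl

  <⇒≤ : ∀ {x y} → x < y → x ≤ y
  <⇒≤ = inj₁

  <-≤-trans : ∀ {x y z} → x < y → y ≤ z → x < z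
  <-≤-trans x<y (inj₁ y<z) = <-trans _ _ _ x<y y<z
  <-≤-trans x<y (inj₂ refl) = x<y

  ≤-<-trans : ∀ {x y z} → x ≤ y → y < z → x < z
  ≤-<-trans (inj₁ x<y) y<z = <-trans _ _ _ x<y y<z
  ≤-<-trans (inj₂ refl) y<z = y<z

  <⊎≥ : ∀ x y → (x < y) ⊎ (y ≤ x)
  <⊎≥ x y with <-trichot x y
  ... | inj₁ x<y = inj₁ x<y
  ... | inj₂ (inj₁ x≡y) = inj₂ (inj₂ (sym x≡y))
  ... | inj₂ (inj₂ y<x) = inj₂ (inj₁ y<x)

  lower-bound : ∀ x y → Σ Carrier λ z → (z ≤ x) × (z ≤ y)
  lower-bound x y with <⊎≥ x y
  ... | inj₁ x<y = x , ≤-refl , <⇒≤ x<y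
  ... | inj₂ y≤x = y , y≤x , ≤-refl

  upper-bound : ∀ x y → Σ Carrier λ z → (x ≤ z) × (y ≤ z)
  upper-bound x y with <⊎≥ x y
  ... | inj₁ x<y = y , <⇒≤ x<y , ≤-refl
  ... | inj₂ y≤x = x , ≤-refl , y≤x

  +-identityʳ : ∀ x → x + 0# ≡ x
  +-identityʳ x = trans (+-comm x 0#) (+-identityˡ x)

  +-inverseʳ : ∀ x → x - x ≡ 0#
  +-inverseʳ x = trans (+-comm x (- x)) (+-inverseˡ x)

  x-y+y≡x : ∀ x y → x - y + y ≡ x
  x-y+y≡x x y = begin
    x + - y + y    ≡⟨ +-assoc x (- y) y ⟩
    x + (- y + y)  ≡⟨ cong (x +_) (+-inverseˡ y) ⟩
    x + 0#         ≡⟨ +-identityʳ x ⟩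
    x              ∎
    where open ≡-Reasoning

  x+[y-x]≡y : ∀ x y → x + (y - x) ≡ y
  x+[y-x]≡y x y = trans (+-comm x (y - x)) (x-y+y≡x y x)

  +-interchange : ∀ a b c d → (a + b) + (c + d) ≡ (a + c) + (b + d)
  +-interchange a b c d = begin
    (a + b) + (c + d)  ≡⟨ +-assoc a b (c + d) ⟩
    a + (b + (c + d))  ≡⟨ cong (a +_) (sym (+-assoc b c d)) ⟩
    a + ((b + c) + d)  ≡⟨ cong (λ t → a + (t + d)) (+-comm b c) ⟩
    a + ((c + b) + d)  ≡⟨ cong (a +_) (+-assoc c b d) ⟩
    a + (c + (b + d))  ≡⟨ sym (+-assoc a c (b + d)) ⟩
    (a + c) + (b + d)  ∎
    where open ≡-Reasoning

  +-monoʳ-< : ∀ z {x y} → x < y → z + x < z + y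
  +-monoʳ-< z {x} {y} x<y = subst₂ _<_ (+-comm x z) (+-comm y z) (<-+ x y z x<y)

  +-mono-<-≤ : ∀ {a b c d} → a < b → c ≤ d → a + c < b + d
  +-mono-<-≤ {a} {b} {c} a<b (inj₁ c<d) = <-trans _ _ _ (<-+ a b c a<b) (+-monoʳ-< b c<d)
  +-mono-<-≤ {a} {b} {c} a<b (inj₂ refl) = <-+ a b c a<b

  +-mono-≤ : ∀ {a b c d} → a ≤ b → c ≤ d → a + c ≤ b + d
  +-mono-≤ (inj₁ a<b) c≤d = <⇒≤ (+-mono-<-≤ a<b c≤d)
  +-mono-≤ {a} (inj₂ refl) (inj₁ c<d) = <⇒≤ (+-monoʳ-< a c<d)
  +-mono-≤ (inj₂ refl) (inj₂ refl) = ≤-refl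

  x<y⇒0<y-x : ∀ {x y} → x < y → 0# < y - x
  x<y⇒0<y-x {x} {y} x<y = subst (_< y - x) (+-inverseʳ x) (<-+ x y (- x) x<y)

  x<y-z⇒z+x<y : ∀ {x y z} → x < y - z → z + x < y
  x<y-z⇒z+x<y {x} {y} {z} x<y-z = subst (z + x <_) (x+[y-x]≡y z y) (+-monoʳ-< z x<y-z)

  x<x+y : ∀ x {y} → 0# < y → x < x + y
  x<x+y x 0<y = subst (_< x + _) (+-identityʳ x) (+-monoʳ-< x 0<y)

  x-y<x : ∀ x {y} → 0# < y → x - y < x
  x-y<x x {y} 0<y = subst (x - y <_) (x-y+y≡x x y) (x<x+y (x - y) 0<y)

  half : ∀ {d} → 0# < d → Σ Carrier λ e → (0# < e) × (e + e < d)
  half {d} 0<d with <-dense 0# d 0<d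
  ... | c , 0<c , c<d with <⊎≥ c (d - c)
  ...   | inj₁ c<d-c = c , 0<c , x<y-z⇒z+x<y c<d-c
  ...   | inj₂ d-c≤c with <-dense 0# (d - c) (x<y⇒0<y-x c<d)
  ...     | e , 0<e , e<d-c =
    e , 0<e , subst (e + e <_) (x-y+y≡x d c) (+-mono-<-≤ e<d-c (inj₁ (<-≤-trans e<d-c d-c≤c)))

module Multiples {L : Language} (G : Structure L) where
  open Structure G
  open Semantics G
  open DOAGProperties grp

  ·-distrib-+ : ∀ n x y → n · (x + y) ≡ n · x + n · y
  ·-distrib-+ zero    x y = sym (+-identityˡ 0#)
  ·-distrib-+ (suc n) x y = begin
    (x + y) + n · (x + y)        ≡⟨ cong ((x + y) +_) (·-distrib-+ n x y) ⟩
    (x + y) + (n · x + n · y)    ≡⟨ +-interchange x y (n · x) (n · y) ⟩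
    (x + n · x) + (y + n · y)    ∎
    where open ≡-Reasoning

  ·-zero : ∀ n → n · 0# ≡ 0#
  ·-zero zero    = refl
  ·-zero (suc n) = trans (+-identityˡ (n · 0#)) (·-zero n)

  ·-mono-≤ : ∀ n {x y} → x ≤ y → n · x ≤ n · y
  ·-mono-≤ zero    x≤y = ≤-refl
  ·-mono-≤ (suc n) x≤y = +-mono-≤ x≤y (·-mono-≤ n x≤y)

  ·-mono-< : ∀ m {x y} → x < y → suc m · x < suc m · y
  ·-mono-< m x<y = +-mono-<-≤ x<y (·-mono-≤ m (<⇒≤ x<y))

  ·-deflationary : ∀ m {x} → x ≤ 0# → suc m · x ≤ x
  ·-deflationary m {x} x≤0 =
    subst (suc m · x ≤_) (+-identityʳ x) (+-mono-≤ ≤-refl (subst (m · x ≤_) (·-zero m) (·-mono-≤ m x≤0)))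

  ·-inflationary : ∀ m {x} → 0# ≤ x → x ≤ suc m · x
  ·-inflationary m {x} 0≤x =
    subst (_≤ suc m · x) (+-identityʳ x) (+-mono-≤ ≤-refl (subst (_≤ m · x) (·-zero m) (·-mono-≤ m 0≤x)))

  small-multiple : ∀ m {d} → 0# < d → Σ Carrier λ e → (0# < e) × (suc m · e < d)
  small-multiple zero {d} 0<d with <-dense 0# d 0<d
  ... | e , 0<e , e<d = e , 0<e , subst (_< d) (sym (+-identityʳ e)) e<d
  small-multiple (suc m) 0<d with half 0<d
  ... | c , 0<c , c+c<d with small-multiple m 0<c
  ...   | e , 0<e , [1+m]e<c =
    e , 0<e , <-trans _ _ _ (+-mono-<-≤ (≤-<-trans (·-inflationary m (<⇒≤ 0<e)) [1+m]e<c) (<⇒≤ [1+m]e<c)) c+c<d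

module DCIConsequences {L : Language} (G : Structure L) where
  open Structure G
  open Syntax L
  open Semantics G
  open DOAGProperties grp
  open Multiples G

  ContainsLowerRay : (Carrier → Set) → Set
  ContainsLowerRay P = Σ Carrier λ s → ∀ v → v < s → P v

  Progressive : (Carrier → Set) → Set
  Progressive P = ∀ v → (∀ s → s < v → P s) → Σ Carrier λ u → (v < u) × (∀ s → s < u → P s)

  Inductive : (Carrier → Set) → Set
  Inductive P = ContainsLowerRay P × Progressive P

  module Below (m : ℕ) (g : Carrier) where

    n : ℕ
    n = suc m

    below : Carrier → Set
    below v = n · v < g

    below-containsLowerRay : ContainsLowerRay below
    below-containsLowerRay with lower-bound 0# g
    ... | s , s≤0 , s≤g = s , λ v v<s →
      ≤-<-trans (·-deflationary m (<⇒≤ (<-≤-trans v<s s≤0))) (<-≤-trans v<s s≤g)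

    below-proper : ¬ (∀ v → below v)
    below-proper all-below with upper-bound 0# g
    ... | v , 0≤v , g≤v = <-irrefl g (≤-<-trans g≤v (≤-<-trans (·-inflationary m 0≤v) (all-below v)))

    below-open : ∀ {v} → below v → Σ Carrier λ u → (v < u) × (∀ s → s < u → below s)
    below-open {v} nv<g with small-multiple m (x<y⇒0<y-x nv<g)
    ... | e , 0<e , ne<g-nv = v + e , x<x+y v 0<e , λ s s<v+e →
      <-trans _ _ _ (·-mono-< m s<v+e)
        (subst (_< g) (sym (·-distrib-+ n v e)) (x<y-z⇒z+x<y ne<g-nv))

    below-closed : ∀ {v} → (∀ s → s < v → below s) → ¬ (g < n · v)
    below-closed {v} below-v g<nv with small-multiple m (x<y⇒0<y-x g<nv)
    ... | e , 0<e , ne<nv-g = <-irrefl (n · v) (subst (_< n · v) n[v-e]+ne≡nv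
          (subst (n · (v - e) + n · e <_) (x+[y-x]≡y g (n · v))
            (+-mono-<-≤ (below-v (v - e) (x-y<x v 0<e)) (<⇒≤ ne<nv-g))))
      where
      n[v-e]+ne≡nv : n · (v - e) + n · e ≡ n · v
      n[v-e]+ne≡nv = trans (sym (·-distrib-+ n (v - e) e)) (cong (n ·_) (x-y+y≡x v e))

    below-progressive : ¬ (Σ Carrier λ h → n · h ≡ g) → Progressive below
    below-progressive n∤g v below-v with <-trichot (n · v) g
    ... | inj₁ nv<g          = below-open nv<g
    ... | inj₂ (inj₁ nv≡g)   = ⊥-elim (n∤g (v , nv≡g))
    ... | inj₂ (inj₂ g<nv)   = ⊥-elim (below-closed below-v g<nv)

  multipleᵗ : ℕ → Term
  multipleᵗ zero    = zeroᵗ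
  multipleᵗ (suc n) = var 0 ⊕ multipleᵗ n

  eval-multipleᵗ : ∀ n ρ → eval ρ (multipleᵗ n) ≡ n · ρ 0
  eval-multipleᵗ zero    ρ = refl
  eval-multipleᵗ (suc n) ρ = cong (ρ 0 +_) (eval-multipleᵗ n ρ)

  Inductive-cong : ∀ {P Q : Carrier → Set} →
    (∀ {v} → P v → Q v) → (∀ {v} → Q v → P v) → Inductive P → Inductive Q
  Inductive-cong P⇒Q Q⇒P ((s , ray) , progressive) =
    (s , λ v v<s → P⇒Q (ray v v<s)) ,
    λ v Q-below-v → case progressive v (λ s s<v → Q⇒P (Q-below-v s s<v)) of λ where
      (u , v<u , P-below-u) → u , v<u , λ s s<u → P⇒Q (P-below-u s s<u)

  dci-multiple-below : DCI → ∀ n g → Inductive (λ v → n · v < g) → ∀ v → n · v < g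
  dci-multiple-below dci n g ind v = to (dci (multipleᵗ n ≺ var 1) (λ _ → g) (Inductive-cong from to ind) v)
    where
    ρ : Carrier → Assignment
    ρ a = (λ _ → g) [ 0 ↦ a ]
    to : ∀ {a} → eval (ρ a) (multipleᵗ n) < g → n · a < g
    to {a} = subst (_< g) (eval-multipleᵗ n (ρ a))
    from : ∀ {a} → n · a < g → eval (ρ a) (multipleᵗ n) < g
    from {a} = subst (_< g) (sym (eval-multipleᵗ n (ρ a)))

corollary3p3 : ExcludedMiddle → (L : Language) → (G : Structure L) →
    Semantics.DCI G → Semantics.Divisible G
corollary3p3 em L G dci zero    n≢0 g = ⊥-elim (n≢0 refl)
corollary3p3 em L G dci (suc m) _   g with em (Σ (Structure.Carrier G) λ h → Semantics._·_ G (suc m) h ≡ g)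
... | inj₁ [1+m]∣g = [1+m]∣g
... | inj₂ [1+m]∤g =
  ⊥-elim (below-proper (dci-multiple-below dci (suc m) g (below-containsLowerRay , below-progressive [1+m]∤g)))
  where
  open DCIConsequences G
  open Below m g
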